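{- Let $n$ be a positive integer with at least two distinct prime factors, let $q_1$ be the largest prime smaller than $n$, let $p_1^{a_1}$ be the largest prime-power divisor of $n$, and let $p_2^{a_2}$ be the second largest prime-power divisor of $n$. If $p_1^{a_1}p_2^{a_2}>n-q_1$, then every binomial coefficient $\binom{n}{k}$ with $1\le k\le n-1$ is divisible by at least one of $p_1$, $p_2$, $q_1$ (i.e. $n$ satisfies the $3$-variation of Condition 1 with $p_1,p_2,q_1$).
   Context: Here the prime-power divisors of $n$ are the numbers $p^{v_p(n)}$ for primes $p\mid n$, where $v_p(n)$ is the exponent of the largest power of $p$ dividing $n$; thus $p_1\neq p_2$, $a_i=v_{p_i}(n)$, $p_1^{a_1}$ is the largest of these numbers and $p_2^{a_2}$ is the largest among those with $p\neq p_1$. -}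

module Defs where

open import Data.Nat using (ℕ; suc; _^_; _≤_; _<_)
open import Data.Nat.Divisibility using (_∣_)
open import Data.Nat.Primality using (Prime)
open import Data.Product using (_×_)
open import Relation.Nullary using (¬_)
open import Relation.Binary.PropositionalEquality using (_≢_)

IsValuation : ℕ → ℕ → ℕ → Set
IsValuation p a n = (p ^ a ∣ n) × ¬ (p ^ suc a ∣ n)

HasTwoDistinctPrimeFactors : ℕ → Set
HasTwoDistinctPrimeFactors n =
  Data.Product.∃ λ p → Data.Product.∃ λ q →
    Prime p × Prime q × p ≢ q × p ∣ n × q ∣ n

IsLargestPrimeBelow : ℕ → ℕ → Set
IsLargestPrimeBelow q n = Prime q × q < n × (∀ p → Prime p → p < n → p ≤ q)

module Submission where

-- Fix 1 ≤ k ≤ n - 1 and suppose neither p₁ nor p₂ divides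
-- C(n,k).  For a prime p with p^a ∣ n and p ∤ C(n,k), the absorption
-- identity k·C(n,k) = n·C(n-1,k-1) shows p^a ∣ k; by the symmetry
-- C(n,k) = C(n,n-k) also p^a ∣ n - k.  As p₁ ≠ p₂, the product
-- P = p₁^a₁·p₂^a₂ divides both k and n - k, so both are ≥ P > n - q₁,
-- i.e. both k and n - k are < q₁.  Finally the prime q₁ ≤ n divides
-- n! = C(n,k)·k!·(n-k)! but neither k! nor (n-k)!, so q₁ ∣ C(n,k).

open import Defs
open import Data.Nat using (ℕ; suc; _^_; _*_; _∸_; _≤_; _<_; _>_)
open import Data.Nat.Divisibility using (_∣_)
open import Data.Nat.Primality using (Prime)
open import Data.Nat.Combinatorics using (_C_)
open import Data.Sum using (_⊎_)
open import Relation.Binary.PropositionalEquality using (_≢_)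

open import Data.Nat.Base using (zero; _!; s≤s; >-nonZero)
open import Data.Nat.Properties
open import Data.Nat.Divisibility
open import Data.Nat.Primality
open import Data.Nat.Combinatorics
open import Data.Nat.DivMod using (_/_; m/n*n≡m)
open import Data.Nat.Tactic.RingSolver using (solve-∀)
open import Data.Sum using (inj₁; inj₂)
open import Data.Product using (_×_; _,_; proj₁; proj₂)
open import Relation.Nullary using (¬_; yes; no; contradiction)
open import Relation.Binary.PropositionalEquality

binomial-factorial : ∀ {n k} → k ≤ n → (n C k) * (k ! * (n ∸ k) !) ≡ n !
binomial-factorial {n} {k} k≤n = begin
  (n C k) * (k ! * (n ∸ k) !)                 ≡⟨ cong (_* (k ! * (n ∸ k) !)) (nCk≡n!/k![n-k]! k≤n) ⟩
  (n ! / (k ! * (n ∸ k) !)) * (k ! * (n ∸ k) !) ≡⟨ m/n*n≡m (k![n∸k]!∣n! k≤n) ⟩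
  n !                                           ∎
  where
  open ≡-Reasoning
  instance _ = k !* (n ∸ k) !≢0

-- The absorption identity (j+1) · C(m+1, j+1) = (m+1) · C(m, j),
-- obtained by cancelling j! (m-j)! from both factorial forms.
absorption : ∀ m j → j ≤ m → suc j * (suc m C suc j) ≡ suc m * (m C j)
absorption m j j≤m = *-cancelʳ-≡ _ _ (j ! * (m ∸ j) !) (begin
  (suc j * C⁺) * (j ! * (m ∸ j) !) ≡⟨ regroup (suc j) C⁺ (j !) ((m ∸ j) !) ⟩
  C⁺ * (suc j ! * (m ∸ j) !)       ≡⟨ binomial-factorial (s≤s j≤m) ⟩
  suc m !                           ≡⟨ cong (suc m *_) (binomial-factorial j≤m) ⟨
  suc m * ((m C j) * (j ! * (m ∸ j) !)) ≡⟨ *-assoc (suc m) (m C j) _ ⟨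
  (suc m * (m C j)) * (j ! * (m ∸ j) !) ∎)
  where
  open ≡-Reasoning
  C⁺ = suc m C suc j
  instance _ = j !* (m ∸ j) !≢0
  regroup : ∀ a c d e → (a * c) * (d * e) ≡ c * ((a * d) * e)
  regroup = solve-∀

prime∤factorial : ∀ {q} → Prime q → ∀ m → m < q → ¬ q ∣ m !
prime∤factorial q-prime zero _ q∣1 = ¬prime[1] (subst Prime (∣1⇒≡1 q∣1) q-prime)
prime∤factorial q-prime (suc m) m<q q∣m! with euclidsLemma (suc m) (m !) q-prime q∣m!
... | inj₁ q∣1+m = >⇒∤ m<q q∣1+m
... | inj₂ q∣m!  = prime∤factorial q-prime m (<-trans (n<1+n m) m<q) q∣m!

≤⇒∣factorial : ∀ q m → q ≤ m → suc q ∣ suc m !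
≤⇒∣factorial q m q≤m = ∣-trans (m∣m*n (q !)) (m≤n⇒m!∣n! (s≤s q≤m))

prime∤power : ∀ {p q} → Prime p → Prime q → q ≢ p → ∀ a → ¬ q ∣ p ^ a
prime∤power p-prime q-prime q≢p zero q∣1 = ¬prime[1] (subst Prime (∣1⇒≡1 q∣1) q-prime)
prime∤power p-prime q-prime q≢p (suc a) q∣p^[1+a]
  with euclidsLemma _ _ q-prime q∣p^[1+a]
... | inj₂ q∣p^a = prime∤power p-prime q-prime q≢p a q∣p^a
... | inj₁ q∣p with prime⇒irreducible p-prime q∣p
...   | inj₁ q≡1 = ¬prime[1] (subst Prime q≡1 q-prime)
...   | inj₂ q≡p = q≢p q≡p

prime-power-cancel : ∀ {p c} → Prime p → ¬ p ∣ c → ∀ a x → p ^ a ∣ x * c → p ^ a ∣ x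
prime-power-cancel p-prime p∤c zero x _ = 1∣ x
prime-power-cancel {p} {c} p-prime p∤c (suc a) x p^[1+a]∣xc
  with euclidsLemma x c p-prime (m*n∣⇒m∣ p (p ^ a) p^[1+a]∣xc)
... | inj₂ p∣c = contradiction p∣c p∤c
... | inj₁ (divides y refl) =
  subst (p * p ^ a ∣_) (*-comm p y) (*-monoʳ-∣ p p^a∣y)
  where
  instance _ = prime⇒nonZero p-prime
  p^a∣y : p ^ a ∣ y
  p^a∣y = prime-power-cancel p-prime p∤c a y (*-cancelˡ-∣ p
    (subst (p * p ^ a ∣_) (trans (cong (_* c) (*-comm y p)) (*-assoc p y c)) p^[1+a]∣xc))

prime-powers-∣ : ∀ {p q x} a b → Prime p → Prime q → q ≢ p →
                 p ^ a ∣ x → q ^ b ∣ x → p ^ a * q ^ b ∣ x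
prime-powers-∣ {p} {q} a b p-prime q-prime q≢p (divides y refl) q^b∣x =
  subst (p ^ a * q ^ b ∣_) (*-comm (p ^ a) y) (*-monoʳ-∣ (p ^ a) q^b∣y)
  where
  q^b∣y : q ^ b ∣ y
  q^b∣y = prime-power-cancel q-prime (prime∤power p-prime q-prime q≢p a) b y q^b∣x

-- If p^a ∣ n but the prime p does not divide C(n,k) (0 < k ≤ n),
-- then p^a ∣ k: p^a divides n·C(n-1,k-1) = k·C(n,k), and C(n,k) is prime to p.
prime-power-∣-index : ∀ {p n k} a → Prime p → p ^ a ∣ n → ¬ p ∣ n C k →
                      1 ≤ k → k ≤ n → p ^ a ∣ k
prime-power-∣-index {p} {suc m} {suc j} a p-prime p^a∣n p∤C _ (s≤s j≤m) =
  prime-power-cancel p-prime p∤C a (suc j)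
    (subst (p ^ a ∣_) (sym (absorption m j j≤m)) (∣m⇒∣m*n (m C j) p^a∣n))

-- The same holds for the complementary index n - k, by C(n,k) = C(n,n-k).
prime-power-∣-coindex : ∀ {p n k} a → Prime p → p ^ a ∣ n → ¬ p ∣ n C k →
                        k < n → p ^ a ∣ n ∸ k
prime-power-∣-coindex {n = n} {k} a p-prime p^a∣n p∤C k<n =
  prime-power-∣-index a p-prime p^a∣n (subst (λ c → ¬ _ ∣ c) (nCk≡nC[n∸k] (<⇒≤ k<n)) p∤C)
    (m<n⇒0<n∸m k<n) (m∸n≤m n k)

-- A prime q ≤ n exceeding both k and n - k divides C(n,k): it divides
-- n! = C(n,k)·k!·(n-k)! but neither k! nor (n-k)!.
large-prime-∣-binomial : ∀ {q n k} → Prime q → q ≤ n → k ≤ n → k < q → n ∸ k < q →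
                         q ∣ n C k
large-prime-∣-binomial {q@(suc q′)} {n@(suc m)} {k} q-prime (s≤s q′≤m) k≤n k<q n∸k<q
  with euclidsLemma (n C k) (k ! * (n ∸ k) !) q-prime q∣C·k!·[n∸k]!
  where
  q∣C·k!·[n∸k]! : q ∣ (n C k) * (k ! * (n ∸ k) !)
  q∣C·k!·[n∸k]! = subst (q ∣_) (sym (binomial-factorial k≤n)) (≤⇒∣factorial q′ m q′≤m)
... | inj₁ q∣C = q∣C
... | inj₂ q∣k!·[n∸k]! with euclidsLemma (k !) ((n ∸ k) !) q-prime q∣k!·[n∸k]!
...   | inj₁ q∣k!     = contradiction q∣k! (prime∤factorial q-prime k k<q)
...   | inj₂ q∣[n∸k]! = contradiction q∣[n∸k]! (prime∤factorial q-prime (n ∸ k) n∸k<q)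

parts-below : ∀ {n q k} → q ≤ n → k ≤ n → n ∸ q < k → n ∸ q < n ∸ k →
              k < q × n ∸ k < q
parts-below {n} {q} {k} q≤n k≤n n∸q<k n∸q<n∸k =
  subst (_< q) (m∸[m∸n]≡n k≤n) (complement (m∸n≤m n k) n∸q<n∸k) , complement k≤n n∸q<k
  where
  complement : ∀ {x} → x ≤ n → n ∸ q < x → n ∸ x < q
  complement {x} x≤n n∸q<x = subst (n ∸ x <_) (m∸[m∸n]≡n q≤n) (∸-monoʳ-< n∸q<x x≤n)

proposition4p2 : (n q₁ p₁ a₁ p₂ a₂ : ℕ) → 1 ≤ n → HasTwoDistinctPrimeFactors n
    → IsLargestPrimeBelow q₁ n
    → Prime p₁ → p₁ ∣ n → IsValuation p₁ a₁ n
    → Prime p₂ → p₂ ∣ n → IsValuation p₂ a₂ n → p₂ ≢ p₁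
    → (∀ p a → Prime p → p ∣ n → IsValuation p a n → p ^ a ≤ p₁ ^ a₁)
    → (∀ p a → Prime p → p ∣ n → p ≢ p₁ → IsValuation p a n → p ^ a ≤ p₂ ^ a₂)
    → p₁ ^ a₁ * p₂ ^ a₂ > n ∸ q₁
    → ∀ k → 1 ≤ k → k ≤ n ∸ 1
    → (p₁ ∣ n C k) ⊎ (p₂ ∣ n C k) ⊎ (q₁ ∣ n C k)
proposition4p2 (suc m) q₁ p₁ a₁ p₂ a₂ _ _ (q₁-prime , q₁<n , _)
               p₁-prime _ (p₁^a₁∣n , _) p₂-prime _ (p₂^a₂∣n , _) p₂≢p₁ _ _
               n∸q₁<P k 1≤k k≤m
  with p₁ ∣? (suc m C k) | p₂ ∣? (suc m C k)
... | yes p₁∣C | _        = inj₁ p₁∣C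
... | no _     | yes p₂∣C = inj₂ (inj₁ p₂∣C)
... | no p₁∤C  | no p₂∤C  = inj₂ (inj₂ (large-prime-∣-binomial q₁-prime q₁≤n k≤n k<q₁ n∸k<q₁))
  where
  n = suc m
  k<n : k < n
  k<n = s≤s k≤m
  k≤n = <⇒≤ k<n
  q₁≤n = <⇒≤ q₁<n
  P = p₁ ^ a₁ * p₂ ^ a₂
  P∣k : P ∣ k
  P∣k = prime-powers-∣ a₁ a₂ p₁-prime p₂-prime p₂≢p₁
    (prime-power-∣-index a₁ p₁-prime p₁^a₁∣n p₁∤C 1≤k k≤n)
    (prime-power-∣-index a₂ p₂-prime p₂^a₂∣n p₂∤C 1≤k k≤n)
  P∣n∸k : P ∣ n ∸ k
  P∣n∸k = prime-powers-∣ a₁ a₂ p₁-prime p₂-prime p₂≢p₁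
    (prime-power-∣-coindex a₁ p₁-prime p₁^a₁∣n p₁∤C k<n)
    (prime-power-∣-coindex a₂ p₂-prime p₂^a₂∣n p₂∤C k<n)
  exceeds : ∀ {x} → 0 < x → P ∣ x → n ∸ q₁ < x
  exceeds 0<x P∣x = <-≤-trans n∸q₁<P (∣⇒≤ {{>-nonZero 0<x}} P∣x)
  below = parts-below q₁≤n k≤n (exceeds 1≤k P∣k) (exceeds (m<n⇒0<n∸m k<n) P∣n∸k)
  k<q₁ = proj₁ below
  n∸k<q₁ = proj₂ below
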